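{- The cut rule is admissible in $\mathsf{GWFCI}$: for all finite multisets $\Gamma,\Gamma'$ of formulas and all formulas $D,E$, if $\Gamma\Rightarrow D$ and $D,\Gamma'\Rightarrow E$ are derivable in $\mathsf{GWFCI}$, then $\Gamma,\Gamma'\Rightarrow E$ is derivable in $\mathsf{GWFCI}$.
   Context: Formulas are built from a countable set of propositional atoms and $\bot$ using $\wedge,\vee,\rightarrow$. Sequents of $\mathsf{GWFCI}$ have the form $\Gamma\Rightarrow C$ with $\Gamma$ a finite multiset of formulas and $C$ a formula. Rules ($p$ atomic): (Ax) $p,\Gamma\Rightarrow p$; ($\bot_L$) $\bot,\Gamma\Rightarrow C$; ($\wedge_L$) from $A,B,\Gamma\Rightarrow C$ infer $A\wedge B,\Gamma\Rightarrow C$; ($\wedge_R$) from $\Gamma\Rightarrow A$ and $\Gamma\Rightarrow B$ infer $\Gamma\Rightarrow A\wedge B$; ($\vee_L$) from $A,\Gamma\Rightarrow C$ and $B,\Gamma\Rightarrow C$ infer $A\vee B,\Gamma\Rightarrow C$; ($\vee_R^1$) from $\Gamma\Rightarrow A$ infer $\Gamma\Rightarrow A\vee B$; ($\vee_R^2$) from $\Gamma\Rightarrow B$ infer $\Gamma\Rightarrow A\vee B$; ($\rightarrow_R$) from $A\Rightarrow B$ infer $\Gamma\Rightarrow A\rightarrow B$; ($\rightarrow_{LR}$) from $A\Rightarrow B$, $B\Rightarrow A$, $C\Rightarrow D$, $D\Rightarrow C$ infer $\Gamma,A\rightarrow C\Rightarrow B\rightarrow D$; ($\rightarrow_I$) from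 $\Gamma\Rightarrow B\rightarrow C$ and $\Gamma\Rightarrow C\rightarrow D$ infer $\Gamma\Rightarrow B\rightarrow D$; ($\rightarrow_C$) from $\Gamma\Rightarrow B\rightarrow C$ and $\Gamma\Rightarrow B\rightarrow D$ infer $\Gamma\Rightarrow B\rightarrow C\wedge D$. Derivability uses only these rules, without cut. -}

module Defs where

open import Data.Nat using (ℕ)
open import Data.List using (List; []; _∷_; [_]; _++_)
open import Data.List.Relation.Binary.Permutation.Propositional using (_↭_)

data Formula : Set where
  atom : ℕ → Formula
  ⊥'   : Formula
  _∧'_ : Formula → Formula → Formula
  _∨'_ : Formula → Formula → Formula
  _⇒'_ : Formula → Formula → Formula

infixr 6 _∧'_
infixr 5 _∨'_
infixr 4 _⇒'_

-- Contexts are finite multisets, represented as lists taken up to permutation: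
-- every rule whose conclusion has a distinguished antecedent formula applies
-- to any list Δ that is a permutation of (principal formulas ++ Γ).
Ctx : Set
Ctx = List Formula

infix 2 _⊢_

data _⊢_ : Ctx → Formula → Set where
  Ax   : ∀ {Γ Δ} p → Δ ↭ (atom p ∷ Γ) → Δ ⊢ atom p
  ⊥L   : ∀ {Γ Δ C} → Δ ↭ (⊥' ∷ Γ) → Δ ⊢ C
  ∧L   : ∀ {Γ Δ A B C} → Δ ↭ ((A ∧' B) ∷ Γ) → (A ∷ B ∷ Γ) ⊢ C → Δ ⊢ C
  ∧R   : ∀ {Γ A B} → Γ ⊢ A → Γ ⊢ B → Γ ⊢ A ∧' B
  ∨L   : ∀ {Γ Δ A B C} → Δ ↭ ((A ∨' B) ∷ Γ) → (A ∷ Γ) ⊢ C → (B ∷ Γ) ⊢ C → Δ ⊢ C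
  ∨R₁  : ∀ {Γ A B} → Γ ⊢ A → Γ ⊢ A ∨' B
  ∨R₂  : ∀ {Γ A B} → Γ ⊢ B → Γ ⊢ A ∨' B
  ⇒R   : ∀ {Γ A B} → [ A ] ⊢ B → Γ ⊢ A ⇒' B
  ⇒LR  : ∀ {Γ Δ A B C D} → Δ ↭ ((A ⇒' C) ∷ Γ) →
         [ A ] ⊢ B → [ B ] ⊢ A → [ C ] ⊢ D → [ D ] ⊢ C → Δ ⊢ B ⇒' D
  ⇒I   : ∀ {Γ B C D} → Γ ⊢ B ⇒' C → Γ ⊢ C ⇒' D → Γ ⊢ B ⇒' D
  ⇒C   : ∀ {Γ B C D} → Γ ⊢ B ⇒' C → Γ ⊢ B ⇒' D → Γ ⊢ B ⇒' (C ∧' D)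

{-# OPTIONS --safe #-}
-- Cut is eliminated by induction on the cut formula and then on the derivation of
-- the right premise, in the context-sharing form  Γ ⊢ D , D ∷ Γ ⊢ E  ⟹  Γ ⊢ E,
-- so that contraction is never needed.  A cut that is not principal on the right
-- is permuted upwards, using that ∧L and ∨L are invertible to bring the left
-- premise into the context of the right premise's premises.  Principal cuts reduce
-- to cuts on subformulas, except for implications: since →R and →LR discard the
-- context, a cut of Γ ⊢ A → C against →LR is replaced by chaining B → A, A → C and
-- C → D with →I, and needs no induction at all.
module Submission where

open import Defs
open import Data.List using ([]; _∷_; [_]; _++_)
open import Data.List.Relation.Binary.Permutation.Propositional
open import Data.List.Relation.Binary.Permutation.Propositional.Properties
  using (∈-resp-↭; drop-∷; shift; shifts; ++⁺ˡ; ++⁺ʳ; ++-comm)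
open import Data.List.Membership.Propositional.Properties using (∈-∃++)
open import Data.List.Relation.Unary.Any using (here; there)
open import Data.Product using (∃-syntax; _×_; _,_)
open import Data.Sum using (_⊎_; inj₁; inj₂)
open import Relation.Binary.Definitions using (_Respects_)
open import Relation.Binary.PropositionalEquality using (_≡_; refl)

private variable
  A B C D E F G : Formula
  Γ Γ₀ Δ Ψ : Ctx

∷↭∷-inv : ∀ {x y : Formula} {xs ys} → x ∷ xs ↭ y ∷ ys →
  (x ≡ y × xs ↭ ys) ⊎ (∃[ zs ] ys ↭ x ∷ zs × xs ↭ y ∷ zs)
∷↭∷-inv {x} {y} {xs} {ys} p with ∈-resp-↭ (↭-sym p) (here refl)
... | here refl = inj₁ (refl , drop-∷ p)
... | there y∈xs with ∈-∃++ y∈xs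
... | as , bs , refl = inj₂ (as ++ bs , drop-∷ y∷ys↭y∷x∷zs , shift y as bs)
  where
  y∷ys↭y∷x∷zs : y ∷ ys ↭ y ∷ x ∷ as ++ bs
  y∷ys↭y∷x∷zs = ↭-trans (↭-sym p) (↭-trans (prep x (shift y as bs)) (swap x y refl))

principal-or-side : Δ ↭ G ∷ Γ₀ → Δ ↭ F ∷ Γ →
  (G ≡ F × Γ₀ ↭ Γ) ⊎ (∃[ zs ] Γ ↭ G ∷ zs × Γ₀ ↭ F ∷ zs)
principal-or-side q r = ∷↭∷-inv (↭-trans (↭-sym q) r)

++-↭-∷ : ∀ Φ → Δ ↭ F ∷ Γ → Φ ++ Δ ↭ F ∷ Φ ++ Γ
++-↭-∷ {F = F} {Γ} Φ p = ↭-trans (++⁺ˡ Φ p) (shift F Φ Γ)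

⊢-resp-↭ : (_⊢ C) Respects _↭_
⊢-resp-↭ p (Ax a q)          = Ax a (↭-trans (↭-sym p) q)
⊢-resp-↭ p (⊥L q)            = ⊥L (↭-trans (↭-sym p) q)
⊢-resp-↭ p (∧L q d)          = ∧L (↭-trans (↭-sym p) q) d
⊢-resp-↭ p (∧R d e)          = ∧R (⊢-resp-↭ p d) (⊢-resp-↭ p e)
⊢-resp-↭ p (∨L q d e)        = ∨L (↭-trans (↭-sym p) q) d e
⊢-resp-↭ p (∨R₁ d)           = ∨R₁ (⊢-resp-↭ p d)
⊢-resp-↭ p (∨R₂ d)           = ∨R₂ (⊢-resp-↭ p d)
⊢-resp-↭ p (⇒R d)            = ⇒R d
⊢-resp-↭ p (⇒LR q a b c d)   = ⇒LR (↭-trans (↭-sym p) q) a b c d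
⊢-resp-↭ p (⇒I d e)          = ⇒I (⊢-resp-↭ p d) (⊢-resp-↭ p e)
⊢-resp-↭ p (⇒C d e)          = ⇒C (⊢-resp-↭ p d) (⊢-resp-↭ p e)

weaken : ∀ Ω → Δ ⊢ C → Δ ++ Ω ⊢ C
weaken Ω (Ax a q)        = Ax a (++⁺ʳ Ω q)
weaken Ω (⊥L q)          = ⊥L (++⁺ʳ Ω q)
weaken Ω (∧L q d)        = ∧L (++⁺ʳ Ω q) (weaken Ω d)
weaken Ω (∧R d e)        = ∧R (weaken Ω d) (weaken Ω e)
weaken Ω (∨L q d e)      = ∨L (++⁺ʳ Ω q) (weaken Ω d) (weaken Ω e)
weaken Ω (∨R₁ d)         = ∨R₁ (weaken Ω d)
weaken Ω (∨R₂ d)         = ∨R₂ (weaken Ω d)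
weaken Ω (⇒R d)          = ⇒R d
weaken Ω (⇒LR q a b c d) = ⇒LR (++⁺ʳ Ω q) a b c d
weaken Ω (⇒I d e)        = ⇒I (weaken Ω d) (weaken Ω e)
weaken Ω (⇒C d e)        = ⇒C (weaken Ω d) (weaken Ω e)

weaken-∷ : Γ ⊢ C → A ∷ Γ ⊢ C
weaken-∷ {Γ} {A = A} d = ⊢-resp-↭ (++-comm Γ [ A ]) (weaken [ A ] d)

data LeftPremise : Formula → Ctx → Set where
  ∧-premise  : LeftPremise (A ∧' B) (A ∷ B ∷ [])
  ∨-premise₁ : LeftPremise (A ∨' B) [ A ]
  ∨-premise₂ : LeftPremise (A ∨' B) [ B ]

left-invertible : LeftPremise F Ψ → Δ ⊢ C → Δ ↭ F ∷ Γ → Ψ ++ Γ ⊢ C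
left-invertible π (Ax a q) r with principal-or-side q r
... | inj₁ (refl , _) with () ← π
... | inj₂ (_ , g , _) = Ax a (++-↭-∷ _ g)
left-invertible π (⊥L q) r with principal-or-side q r
... | inj₁ (refl , _) with () ← π
... | inj₂ (_ , g , _) = ⊥L (++-↭-∷ _ g)
left-invertible π (⇒LR q a b c d) r with principal-or-side q r
... | inj₁ (refl , _) with () ← π
... | inj₂ (_ , g , _) = ⇒LR (++-↭-∷ _ g) a b c d
left-invertible {Ψ = Ψ} π (∧L {A = P} {B = Q} q d) r with principal-or-side q r
... | inj₁ (refl , e) with ∧-premise ← π = ⊢-resp-↭ (++⁺ˡ (P ∷ Q ∷ []) e) d
... | inj₂ (_ , g , h) =
  ∧L (++-↭-∷ Ψ g) (⊢-resp-↭ (shifts Ψ (P ∷ Q ∷ [])) (left-invertible π d (++-↭-∷ (P ∷ Q ∷ []) h)))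
left-invertible π (∨L {A = P} {B = Q} q d e) r with principal-or-side q r
... | inj₁ (refl , g) with π
...   | ∨-premise₁ = ⊢-resp-↭ (prep P g) d
...   | ∨-premise₂ = ⊢-resp-↭ (prep Q g) e
left-invertible {Ψ = Ψ} π (∨L {A = P} {B = Q} q d e) r | inj₂ (_ , g , h) =
  ∨L (++-↭-∷ Ψ g) (⊢-resp-↭ (shifts Ψ [ P ]) (left-invertible π d (++-↭-∷ [ P ] h)))
                  (⊢-resp-↭ (shifts Ψ [ Q ]) (left-invertible π e (++-↭-∷ [ Q ] h)))
left-invertible π (∧R d e) r = ∧R (left-invertible π d r) (left-invertible π e r)
left-invertible π (∨R₁ d)  r = ∨R₁ (left-invertible π d r)
left-invertible π (∨R₂ d)  r = ∨R₂ (left-invertible π d r)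
left-invertible π (⇒R d)   r = ⇒R d
left-invertible π (⇒I d e) r = ⇒I (left-invertible π d r) (left-invertible π e r)
left-invertible π (⇒C d e) r = ⇒C (left-invertible π d r) (left-invertible π e r)

left-invertible-∷ : LeftPremise F Ψ → A ∷ Γ ⊢ C → Γ ↭ F ∷ Γ₀ → A ∷ Ψ ++ Γ₀ ⊢ C
left-invertible-∷ {Ψ = Ψ} {A} π d q =
  ⊢-resp-↭ (shifts Ψ [ A ]) (left-invertible π d (++-↭-∷ [ A ] q))

ex-falso : Γ ⊢ ⊥' → Γ ⊢ C
ex-falso (⊥L q)     = ⊥L q
ex-falso (∧L q d)   = ∧L q (ex-falso d)
ex-falso (∨L q d e) = ∨L q (ex-falso d) (ex-falso e)

∧R-inv : Γ ⊢ A ∧' B → (Γ ⊢ A) × (Γ ⊢ B)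
∧R-inv (⊥L q)     = ⊥L q , ⊥L q
∧R-inv (∧L q d)   with ∧R-inv d
... | d₁ , d₂ = ∧L q d₁ , ∧L q d₂
∧R-inv (∨L q d e) with ∧R-inv d | ∧R-inv e
... | d₁ , d₂ | e₁ , e₂ = ∨L q d₁ e₁ , ∨L q d₂ e₂
∧R-inv (∧R d e)   = d , e

mutual
  additive-cut : Γ ⊢ D → Δ ⊢ E → Δ ↭ D ∷ Γ → Γ ⊢ E
  additive-cut l (Ax a q) r with principal-or-side q r
  ... | inj₁ (refl , _)    = l
  ... | inj₂ (_ , g , _)   = Ax a g
  additive-cut l (⊥L q) r with principal-or-side q r
  ... | inj₁ (refl , _)    = ex-falso l
  ... | inj₂ (_ , g , _)   = ⊥L g
  additive-cut l (∧L {A = P} {B = Q} q d) r with principal-or-side q r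
  ... | inj₁ (refl , e) with ∧R-inv l
  ...   | l₁ , l₂ = additive-cut l₂ (additive-cut (weaken-∷ l₁) d (prep P (prep Q e))) refl
  additive-cut l (∧L {A = P} {B = Q} q d) r | inj₂ (_ , g , h) =
    ∧L g (additive-cut (left-invertible ∧-premise l g) d (++-↭-∷ (P ∷ Q ∷ []) h))
  additive-cut l (∨L {A = P} {B = Q} q d e) r with principal-or-side q r
  ... | inj₁ (refl , g)    = ∨-cut l (⊢-resp-↭ (prep P g) d) (⊢-resp-↭ (prep Q g) e)
  ... | inj₂ (_ , g , h)   =
    ∨L g (additive-cut (left-invertible ∨-premise₁ l g) d (++-↭-∷ [ P ] h))
         (additive-cut (left-invertible ∨-premise₂ l g) e (++-↭-∷ [ Q ] h))
  additive-cut l (⇒LR q a b c d) r with principal-or-side q r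
  ... | inj₁ (refl , _)    = ⇒I (⇒R b) (⇒I l (⇒R c))
  ... | inj₂ (_ , g , _)   = ⇒LR g a b c d
  additive-cut l (∧R d e) r = ∧R (additive-cut l d r) (additive-cut l e r)
  additive-cut l (∨R₁ d)  r = ∨R₁ (additive-cut l d r)
  additive-cut l (∨R₂ d)  r = ∨R₂ (additive-cut l d r)
  additive-cut l (⇒R d)   r = ⇒R d
  additive-cut l (⇒I d e) r = ⇒I (additive-cut l d r) (additive-cut l e r)
  additive-cut l (⇒C d e) r = ⇒C (additive-cut l d r) (additive-cut l e r)

  ∨-cut : Γ ⊢ A ∨' B → A ∷ Γ ⊢ E → B ∷ Γ ⊢ E → Γ ⊢ E
  ∨-cut (∨R₁ d) r₁ r₂ = additive-cut d r₁ refl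
  ∨-cut (∨R₂ d) r₁ r₂ = additive-cut d r₂ refl
  ∨-cut (⊥L q) r₁ r₂ = ⊥L q
  ∨-cut (∧L q d) r₁ r₂ =
    ∧L q (∨-cut d (left-invertible-∷ ∧-premise r₁ q) (left-invertible-∷ ∧-premise r₂ q))
  ∨-cut (∨L q d e) r₁ r₂ =
    ∨L q (∨-cut d (left-invertible-∷ ∨-premise₁ r₁ q) (left-invertible-∷ ∨-premise₁ r₂ q))
         (∨-cut e (left-invertible-∷ ∨-premise₂ r₁ q) (left-invertible-∷ ∨-premise₂ r₂ q))

mainTheorem17 : ∀ (Γ Γ′ : Ctx) (D E : Formula) →
    Γ ⊢ D → (D ∷ Γ′) ⊢ E → (Γ ++ Γ′) ⊢ E
mainTheorem17 Γ Γ′ D E l r = additive-cut (weaken Γ′ l) (weaken Γ r) (prep D (++-comm Γ′ Γ))
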